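{- For every $n\ge3$, the $n$-sun $S_n$ admits no MAT-labeling.
   Context: The $n$-sun $S_n$ ($n\ge3$) has vertices $u_1,\dots,u_n,w_1,\dots,w_n$ and edges $\{u_i,u_j\}$ for $1\le i<j\le n$, and $\{w_i,u_i\},\{w_i,u_{i+1}\}$ for $1\le i\le n$, where $u_{n+1}=u_1$. MAT-labeling of a graph $G$: for $\lambda:E_G\to\mathbb{Z}_{>0}$ put $\pi_k=\lambda^{ -1}(k)$, $E_k=\pi_1\sqcup\dots\sqcup\pi_k$, $E_0=\varnothing$; $\operatorname{cl}(F)$ is the set of edges whose endvertices are joined by a path of edges in $F$; $\lambda$ is an MAT-labeling if for all $k\ge1$: (ML1) $\pi_k$ is a forest; (ML2) $\operatorname{cl}(\pi_k)\cap E_{k-1}=\varnothing$; (ML3) each $\{u,v\}\in\pi_k$ has exactly $k-1$ vertices $w$ with $\{u,w\},\{v,w\}\in E_{k-1}$. -}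

module Defs where

open import Level using (0ℓ)
open import Data.Nat using (ℕ; zero; suc; _≤_; _<?_)
open import Data.Fin using (Fin; zero; suc; toℕ; fromℕ<)
open import Data.Sum using (_⊎_; inj₁; inj₂)
open import Data.Product using (Σ; _×_; _,_)
open import Data.Empty using (⊥)
open import Data.List using (List; []; _∷_; length; _∷ʳ_)
open import Data.List.Membership.Propositional using (_∈_)
open import Data.List.Relation.Unary.Linked using (Linked)
open import Data.List.Relation.Unary.Unique.Propositional using (Unique)
open import Relation.Binary.Construct.Closure.ReflexiveTransitive using (Star)
open import Relation.Binary.PropositionalEquality using (_≡_; _≢_)
open import Relation.Nullary using (¬_; yes; no)
open import Function.Bundles using (_⇔_)

-- A graph is a vertex type V with an
-- adjacency relation E (symmetric, irreflexive); an edge {u,v} is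
-- represented by either ordered pair (u , v) with E u v.
-- A "set of edges" F is a relation on V contained in E (symmetric).

-- A cycle in F: distinct vertices x, x₁, …, x_m (m ≥ 2, i.e. at least
-- three vertices) with consecutive vertices and x_m, x joined in F.
Cycle : {V : Set} → (V → V → Set) → Set
Cycle {V} F = Σ V λ x → Σ (List V) λ xs →
  Unique (x ∷ xs) × (2 ≤ length xs) × Linked F ((x ∷ xs) ∷ʳ x)

Forest : {V : Set} → (V → V → Set) → Set
Forest F = ¬ Cycle F

Joined : {V : Set} → (V → V → Set) → V → V → Set
Joined F = Star F

HasCard : {V : Set} → (V → Set) → ℕ → Set
HasCard {V} P c = Σ (List V) λ ws →
  Unique ws × (length ws ≡ c) × (∀ w → (w ∈ ws) ⇔ P w)

module Labeling {V : Set} (E : V → V → Set) (lab : V → V → ℕ) where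

  π : ℕ → V → V → Set
  π k u v = E u v × (lab u v ≡ k)

  -- E_k = π_1 ⊔ … ⊔ π_k : edges with label ≤ k (labels are positive)
  Eₖ : ℕ → V → V → Set
  Eₖ k u v = E u v × (lab u v ≤ k)

  IsLabeling : Set
  IsLabeling = ∀ u v → E u v → (1 ≤ lab u v) × (lab u v ≡ lab v u)

  -- conditions for k = suc j (so E_{k-1} = Eₖ j)
  ML1 : ℕ → Set
  ML1 k = Forest (π k)

  ML2 : ℕ → Set
  ML2 j = ∀ u v → Eₖ j u v → ¬ Joined (π (suc j)) u v

  ML3 : ℕ → Set
  ML3 j = ∀ u v → π (suc j) u v →
    HasCard (λ w → Eₖ j u w × Eₖ j v w) j

  IsMAT : Set
  IsMAT = IsLabeling × (∀ j → ML1 (suc j) × ML2 j × ML3 j)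

-- The n-sun.  Vertices: inj₁ i = u_i, inj₂ i = w_i  (i : Fin n).

next : ∀ {n} → Fin n → Fin n
next {zero} ()
next {suc n} i with suc (toℕ i) <? suc n
... | yes p = fromℕ< p
... | no _ = zero

SunVertex : ℕ → Set
SunVertex n = Fin n ⊎ Fin n

SunAdj : (n : ℕ) → SunVertex n → SunVertex n → Set
SunAdj n (inj₁ i) (inj₁ j) = i ≢ j
SunAdj n (inj₁ i) (inj₂ j) = (i ≡ j) ⊎ (i ≡ next j)
SunAdj n (inj₂ i) (inj₁ j) = (j ≡ i) ⊎ (j ≡ next i)
SunAdj n (inj₂ i) (inj₂ j) = ⊥

IsMATLabeling : {V : Set} → (V → V → Set) → (V → V → ℕ) → Set
IsMATLabeling E lab = Labeling.IsMAT E lab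

-- Look at the triangle u_i w_i u_{i+1} of the sun.  The vertex w_i has no
-- neighbours besides u_i and u_{i+1}, so each of the edges u_i w_i and
-- w_i u_{i+1} has exactly one common neighbour.  By (ML3) an edge labelled
-- k has k - 1 common neighbours in E_{k-1}, hence such an edge has label 1,
-- or label 2 and then the third edge of the triangle has label 1.  Either
-- way u_i and u_{i+1} are joined in π_1 directly or through w_i, and going
-- once around the sun gives a cycle in π_1, contradicting (ML1) for k = 1.
module Submission where

open import Defs
open import Data.Nat using (ℕ; zero; suc; _≤_; _<_; z≤n; s≤s; s≤s⁻¹; z<s; _<?_)
open import Data.Nat.Properties
  using (≤-refl; ≤-trans; ≤-antisym; <-irrefl; <⇒≤; n<1+n; m≤n⇒m≤1+n; m<m+n)
open import Data.Fin using (Fin; zero; toℕ)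
open import Data.Fin.Properties using (toℕ-fromℕ<)
open import Data.Sum using (_⊎_; inj₁; inj₂; reduce)
open import Data.Product using (∃; _×_; _,_; proj₁; proj₂)
open import Data.Empty using (⊥-elim)
open import Data.List using (List; []; _∷_; _++_; _∷ʳ_; length)
open import Data.List.Properties using (++-assoc; length-++)
open import Data.List.Membership.Propositional using (_∈_)
open import Data.List.Relation.Unary.All as All using (All; []; _∷_)
open import Data.List.Relation.Unary.All.Properties as All using ()
open import Data.List.Relation.Unary.AllPairs using ([]; _∷_)
open import Data.List.Relation.Unary.Any using (here; there)
open import Data.List.Relation.Unary.Linked using (Linked; []; [-]; _∷_)
open import Data.List.Relation.Unary.Unique.Propositional using (Unique)
import Data.List.Relation.Unary.Unique.Propositional.Properties as Unique
open import Relation.Binary.Definitions using (Symmetric)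
open import Relation.Binary.PropositionalEquality using (_≡_; refl; sym; trans; cong; subst; module ≡-Reasoning)
open import Relation.Nullary using (¬_; yes; no; contradiction)
open import Function.Bundles using (Equivalence)

linked-join : ∀ {A : Set} {R : A → A → Set} xs {y ys} →
  Linked R (xs ∷ʳ y) → Linked R (y ∷ ys) → Linked R (xs ++ y ∷ ys)
linked-join []            _           l = l
linked-join (_ ∷ [])      (r ∷ [-])   l = r ∷ l
linked-join (_ ∷ _ ∷ xs)  (r ∷ rs)    l = r ∷ linked-join (_ ∷ xs) rs l

module _ {V : Set} {P : V → Set} where

  HasCard-suc⇒∃ : ∀ {c} → HasCard P (suc c) → ∃ P
  HasCard-suc⇒∃ ([] , _ , () , _)
  HasCard-suc⇒∃ (w ∷ _ , _ , _ , iff) = w , Equivalence.to (iff w) (here refl)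

  HasCard-≤1 : (∀ {a b} → P a → P b → a ≡ b) → ∀ {c} → HasCard P c → c ≤ 1
  HasCard-≤1 _ ([] , _ , refl , _) = z≤n
  HasCard-≤1 _ (_ ∷ [] , _ , refl , _) = ≤-refl
  HasCard-≤1 subsingleton (a ∷ b ∷ _ , ((a≢b ∷ _) ∷ _) , _ , iff) =
    ⊥-elim (a≢b (subsingleton (Equivalence.to (iff a) (here refl))
                              (Equivalence.to (iff b) (there (here refl)))))

module _ {V : Set} {E : V → V → Set} {lab : V → V → ℕ}
         (E-sym : Symmetric E) (mat : IsMATLabeling E lab) where

  open Labeling E lab

  π-sym : ∀ {k} → Symmetric (π k)
  π-sym {x = x} {y} (e , l) = E-sym e , trans (sym (proj₂ (proj₁ mat x y e))) l

  ml3 : ∀ j → ML3 j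
  ml3 j = proj₂ (proj₂ (proj₂ mat j))

  common-neighbours-unique : ∀ {x y t} → (∀ w → E x w → E y w → w ≡ t) →
    ∀ {k a b} → Eₖ k x a × Eₖ k y a → Eₖ k x b × Eₖ k y b → a ≡ b
  common-neighbours-unique only ((exa , _) , (eya , _)) ((exb , _) , (eyb , _)) =
    trans (only _ exa eya) (sym (only _ exb eyb))

  lab≡1⊎π₁-to-unique-common-neighbour : ∀ {x y t} → E x y →
    (∀ w → E x w → E y w → w ≡ t) → lab x y ≡ 1 ⊎ π 1 x t
  lab≡1⊎π₁-to-unique-common-neighbour {x} {y} {t} e only
    with lab x y in eq | proj₁ (proj₁ mat x y e)
  ... | zero | ()
  ... | suc zero | _ = inj₁ refl
  ... | suc (suc zero) | _ =
    let w , (exw , lw) , (eyw , _) = HasCard-suc⇒∃ (ml3 1 x y (e , eq))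
    in  inj₂ (subst (π 1 x) (only w exw eyw)
                    (exw , ≤-antisym lw (proj₁ (proj₁ mat x w exw))))
  ... | suc (suc (suc j)) | _ =
    contradiction (HasCard-≤1 (common-neighbours-unique only) (ml3 (suc (suc j)) x y (e , eq)))
                  λ { (s≤s ()) }

  π₁-across-triangle : ∀ {x y z} → E x y → E z y →
    (∀ w → E x w → E y w → w ≡ z) → (∀ w → E z w → E y w → w ≡ x) →
    π 1 x z ⊎ (π 1 x y × π 1 y z)
  π₁-across-triangle exy ezy only-z only-x
    with lab≡1⊎π₁-to-unique-common-neighbour exy only-z
       | lab≡1⊎π₁-to-unique-common-neighbour ezy only-x
  ... | inj₂ πxz | _        = inj₁ πxz
  ... | _        | inj₂ πzx = inj₁ (π-sym πzx)
  ... | inj₁ lxy | inj₁ lzy = inj₂ ((exy , lxy) , π-sym (ezy , lzy))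

module Walk {V : Set} (hub : ℕ → V) (detour : ℕ → List V) where

  block : ℕ → List V
  block c = hub c ∷ detour c

  walk : ℕ → List V
  walk zero    = []
  walk (suc c) = walk c ++ block c

  walk-linked : ∀ {R : V → V → Set} → (∀ c → Linked R (block c ∷ʳ hub (suc c))) →
    ∀ c → Linked R (walk c ∷ʳ hub c)
  walk-linked _ zero = [-]
  walk-linked linked (suc c) =
    subst (Linked _) (sym (++-assoc (walk c) (block c) _))
      (linked-join (walk c) (walk-linked linked c) (linked c))

  length-walk : ∀ c → c ≤ length (walk c)
  length-walk zero    = z≤n
  length-walk (suc c) = subst (suc c ≤_) (sym (length-++ (walk c)))
    (≤-trans (s≤s (length-walk c)) (m<m+n (length (walk c)) z<s))

  walk-suc : ∀ c → ∃ λ xs → walk (suc c) ≡ hub 0 ∷ xs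
  walk-suc zero    = detour 0 , refl
  walk-suc (suc c) with walk-suc c
  ... | xs , eq = xs ++ block (suc c) , cong (_++ block (suc c)) eq

  walk-unique : (pos : V → ℕ) (n : ℕ) →
    (∀ {c} → c < n → Unique (block c) × All (λ v → pos v ≡ c) (block c)) →
    ∀ {c} → c ≤ n → Unique (walk c) × All (λ v → pos v < c) (walk c)
  walk-unique pos n blocks {zero}  _   = [] , []
  walk-unique pos n blocks {suc c} c<n with walk-unique pos n blocks (<⇒≤ c<n) | blocks c<n
  ... | unique-walk , walk-below | unique-block , block-at =
    Unique.++⁺ unique-walk unique-block disjoint ,
    All.++⁺ (All.map m≤n⇒m≤1+n walk-below) (All.map (λ { refl → ≤-refl }) block-at)
    where
    disjoint : ∀ {v} → ¬ (v ∈ walk c × v ∈ block c)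
    disjoint (v∈walk , v∈block) =
      <-irrefl (All.lookup block-at v∈block) (All.lookup walk-below v∈walk)

  walk⇒Cycle : ∀ {R : V → V → Set} n → 2 ≤ n → Unique (walk (suc n)) →
    Linked R (walk (suc n) ∷ʳ hub 0) → Cycle R
  walk⇒Cycle n 2≤n unique linked with walk-suc n
  ... | xs , eq =
    hub 0 , xs , subst Unique eq unique ,
    ≤-trans 2≤n (s≤s⁻¹ (subst (suc n ≤_) (cong length eq) (length-walk (suc n)))) ,
    subst (λ ys → Linked _ (ys ∷ʳ hub 0)) eq linked

toℕ-next : ∀ {n} (i : Fin n) → suc (toℕ i) < n → toℕ (next i) ≡ suc (toℕ i)
toℕ-next {suc n} i lt with suc (toℕ i) <? suc n
... | yes q = toℕ-fromℕ< q
... | no q  = ⊥-elim (q lt)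

next-last : ∀ {n} (i : Fin (suc n)) → toℕ i ≡ n → next i ≡ zero
next-last {n} i toℕi≡n with suc (toℕ i) <? suc n
... | yes q = ⊥-elim (<-irrefl (cong suc toℕi≡n) q)
... | no _  = refl

module _ {m : ℕ} where

  nextⁿ : ℕ → Fin (suc m)
  nextⁿ zero    = zero
  nextⁿ (suc k) = next (nextⁿ k)

  toℕ-nextⁿ : ∀ k → k < suc m → toℕ (nextⁿ k) ≡ k
  toℕ-nextⁿ zero    _  = refl
  toℕ-nextⁿ (suc k) lt = begin
    toℕ (next (nextⁿ k)) ≡⟨ toℕ-next (nextⁿ k) (subst (λ j → suc j < suc m) (sym ih) lt) ⟩
    suc (toℕ (nextⁿ k))  ≡⟨ cong suc ih ⟩
    suc k                ∎
    where
    open ≡-Reasoning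
    ih : toℕ (nextⁿ k) ≡ k
    ih = toℕ-nextⁿ k (<⇒≤ lt)

  nextⁿ-period : nextⁿ (suc m) ≡ zero
  nextⁿ-period = next-last (nextⁿ m) (toℕ-nextⁿ m (n<1+n m))

module _ {n : ℕ} where

  SunAdj-sym : Symmetric (SunAdj n)
  SunAdj-sym {inj₁ i} {inj₁ j} i≢j = λ j≡i → i≢j (sym j≡i)
  SunAdj-sym {inj₁ i} {inj₂ j} e   = e
  SunAdj-sym {inj₂ i} {inj₁ j} e   = e

  common-neighbour-u-w : ∀ i v → SunAdj n (inj₁ i) v → SunAdj n (inj₂ i) v →
    v ≡ inj₁ (next i)
  common-neighbour-u-w i (inj₁ _) i≢i (inj₁ refl) = ⊥-elim (i≢i refl)
  common-neighbour-u-w i (inj₁ _) _   (inj₂ refl) = refl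

  common-neighbour-w-u : ∀ i v → SunAdj n (inj₁ (next i)) v → SunAdj n (inj₂ i) v →
    v ≡ inj₁ i
  common-neighbour-w-u i (inj₁ _) _   (inj₁ refl) = refl
  common-neighbour-w-u i (inj₁ _) j≢j (inj₂ refl) = ⊥-elim (j≢j refl)

  index : SunVertex n → Fin n
  index = reduce

module _ (m : ℕ) (lab : SunVertex (suc m) → SunVertex (suc m) → ℕ)
         (mat : IsMATLabeling (SunAdj (suc m)) lab) where

  open Labeling (SunAdj (suc m)) lab

  π₁-around-w : ∀ i →
    π 1 (inj₁ i) (inj₁ (next i)) ⊎
    (π 1 (inj₁ i) (inj₂ i) × π 1 (inj₂ i) (inj₁ (next i)))
  π₁-around-w i = π₁-across-triangle SunAdj-sym mat (inj₁ refl) (inj₂ refl)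
                    (common-neighbour-u-w i) (common-neighbour-w-u i)

  detour : Fin (suc m) → List (SunVertex (suc m))
  detour i with π₁-around-w i
  ... | inj₁ _ = []
  ... | inj₂ _ = inj₂ i ∷ []

  detour-linked : ∀ i → Linked (π 1) ((inj₁ i ∷ detour i) ∷ʳ inj₁ (next i))
  detour-linked i with π₁-around-w i
  ... | inj₁ πuu        = πuu ∷ [-]
  ... | inj₂ (πuw , πwu) = πuw ∷ πwu ∷ [-]

  detour-unique : ∀ i → Unique (inj₁ i ∷ detour i)
  detour-unique i with π₁-around-w i
  ... | inj₁ _ = [] ∷ []
  ... | inj₂ _ = ((λ ()) ∷ []) ∷ [] ∷ []

  detour-index : ∀ i → All (λ v → index v ≡ i) (inj₁ i ∷ detour i)
  detour-index i with π₁-around-w i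
  ... | inj₁ _ = refl ∷ []
  ... | inj₂ _ = refl ∷ refl ∷ []

  open Walk (λ k → inj₁ (nextⁿ k)) (λ k → detour (nextⁿ k))

  π₁-cycle : 2 ≤ m → Cycle (π 1)
  π₁-cycle 2≤m = walk⇒Cycle m 2≤m
    (proj₁ (walk-unique (λ v → toℕ (index v)) (suc m) blocks-sorted ≤-refl))
    (subst (λ i → Linked (π 1) (walk (suc m) ∷ʳ inj₁ i)) nextⁿ-period
       (walk-linked (λ k → detour-linked (nextⁿ k)) (suc m)))
    where
    blocks-sorted : ∀ {c} → c < suc m →
      Unique (block c) × All (λ v → toℕ (index v) ≡ c) (block c)
    blocks-sorted {c} c<n = detour-unique (nextⁿ c) ,
      All.map (λ eq → trans (cong toℕ eq) (toℕ-nextⁿ c c<n)) (detour-index (nextⁿ c))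

corollary4p11 : (n : ℕ) → 3 ≤ n →
    (lab : SunVertex n → SunVertex n → ℕ) → ¬ IsMATLabeling (SunAdj n) lab
corollary4p11 (suc m) (s≤s 2≤m) lab mat = proj₁ (proj₂ mat 0) (π₁-cycle m lab mat 2≤m)
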